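{- Let $k\ge 1$ and let $G=(V,E)$ be a $k$-partite, $k$-uniform hypergraph with given vertex partition $V=V_1\cup\dots\cup V_k$ (every hyperedge contains exactly one vertex of each $V_i$). If $G$ is vertex-separable, then $G$ is edge-separable.
   Context: For vertices $s,t$, an $s$--$t$ path is a sequence of vertices $s=v_1,\dots,v_r=t$ such that for every $i\in[r-1]$ the vertices $v_i$ and $v_{i+1}$ are both contained in some hyperedge of $E$. For hyperedges $e,e'$, an $e$--$e'$ path is a $v$--$v'$ path with $v\in e$ and $v'\in e'$. Two distinct vertices $v,v'$ in the same part $V_i$ are separable if there exists $j\in[k]$, $j\neq i$, such that every $v$--$v'$ path contains a vertex of $V_j$; $G$ is vertex-separable if every two distinct vertices from the same part are separable. Two distinct hyperedges $e,e'$ are separable if there exists $j\in[k]$ such that every $e$--$e'$ path contains a vertex of $V_j$; $G$ is edge-separable if every two distinct hyperedges are separable. -}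

module Defs where

open import Data.Nat using (ℕ; _≥_)
open import Data.Fin using (Fin)
open import Data.List using (List; []; _∷_)
open import Data.List.Relation.Unary.Any using (Any)
open import Data.Product using (Σ; ∃; _×_; _,_)
open import Relation.Binary.PropositionalEquality using (_≡_; _≢_)
open import Relation.Nullary using (¬_)

-- Vertices form the finite set V = Fin n; the partition V = V_1 ∪ ... ∪ V_k is given by
-- part : V → Fin k (v ∈ V_i iff part v ≡ i). A hyperedge contains exactly
-- one vertex of each part, so it is represented by its transversal
-- e : Fin k → V with part (e i) ≡ i.
record KPartiteHypergraph (k : ℕ) : Set₁ where
  field
    n    : ℕ
    part : Fin n → Fin k
    E    : (Fin k → Fin n) → Set
  V : Set
  V = Fin n
  field
    E-transversal : ∀ e → E e → ∀ i → part (e i) ≡ i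

module _ {k : ℕ} (G : KPartiteHypergraph k) where
  open KPartiteHypergraph G

  _∈ₑ_ : V → (Fin k → V) → Set
  v ∈ₑ e = ∃ λ i → e i ≡ v

  Adjacent : V → V → Set
  Adjacent u w = ∃ λ e → E e × u ∈ₑ e × w ∈ₑ e

  data IsPath : V → V → List V → Set where
    single : ∀ v → IsPath v v (v ∷ [])
    step   : ∀ {u w t p} → Adjacent u w → IsPath w t p → IsPath u t (u ∷ p)

  MeetsPart : Fin k → List V → Set
  MeetsPart j p = Any (λ v → part v ≡ j) p

  -- v, v' are separable (assumes they lie in the same part V_i)
  VerticesSeparable : V → V → Set
  VerticesSeparable v v' =
    ∃ λ j → j ≢ part v × (∀ p → IsPath v v' p → MeetsPart j p)

  VertexSeparable : Set
  VertexSeparable = ∀ v v' → v ≢ v' → part v ≡ part v' → VerticesSeparable v v'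

  EdgesSeparable : (Fin k → V) → (Fin k → V) → Set
  EdgesSeparable e e' =
    ∃ λ j → ∀ v v' p → v ∈ₑ e → v' ∈ₑ e' → IsPath v v' p → MeetsPart j p

  -- distinct hyperedges: distinct as vertex sets (transversals differ somewhere)
  EdgeSeparable : Set
  EdgeSeparable = ∀ e e' → E e → E e' → ¬ (∀ i → e i ≡ e' i) → EdgesSeparable e e'

-- Pick a coordinate i where the transversals e and e' differ.  The vertices
-- e i and e' i are distinct and both lie in V_i, so some part V_j with j ≢ i
-- separates them.  Any e–e' path, with e i prepended and e' i appended, is an
-- e i – e' i path and therefore meets V_j; the two added endpoints lie in V_i,
-- so the original path already meets V_j.
module Submission where

open import Defs
open import Data.Nat using (ℕ; _≥_)
open import Data.Fin using (Fin)
open import Data.Fin.Properties using (¬∀⟶∃¬; _≟_)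
open import Data.List using (_∷_; _++_; [_])
open import Data.List.Relation.Unary.Any using (here; there)
open import Data.List.Relation.Unary.Any.Properties using (++⁻)
open import Data.Product using (∃; _,_)
open import Data.Sum using (inj₁; inj₂)
open import Relation.Binary.PropositionalEquality using (_≡_; _≢_; refl; sym; trans)
open import Relation.Nullary using (¬_; contradiction)

module _ {k : ℕ} (G : KPartiteHypergraph k) where
  open KPartiteHypergraph G

  IsPath-snoc : ∀ {u t x p} → IsPath G u t p → Adjacent G t x → IsPath G u x (p ++ [ x ])
  IsPath-snoc (single _) a = step a (single _)
  IsPath-snoc (step a q) b = step a (IsPath-snoc q b)

  IsPath-extend-to-edges : ∀ {e e'} {v v'} {p} i → E e → E e' → _∈ₑ_ G v e → _∈ₑ_ G v' e' →
                           IsPath G v v' p → IsPath G (e i) (e' i) (e i ∷ p ++ [ e' i ])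
  IsPath-extend-to-edges {e} {e'} i Ee Ee' v∈e v'∈e' path =
    step (e , Ee , (i , refl) , v∈e) (IsPath-snoc path (e' , Ee' , v'∈e' , (i , refl)))

  MeetsPart-strip-ends : ∀ {j x y} p → part x ≢ j → part y ≢ j →
                         MeetsPart G j (x ∷ p ++ [ y ]) → MeetsPart G j p
  MeetsPart-strip-ends p x∉Vj y∉Vj (here x∈Vj) = contradiction x∈Vj x∉Vj
  MeetsPart-strip-ends p x∉Vj y∉Vj (there meets) with ++⁻ p meets
  ... | inj₁ meetsP        = meetsP
  ... | inj₂ (here y∈Vj)  = contradiction y∈Vj y∉Vj

  transversals-differ : ∀ (e e' : Fin k → V) → ¬ (∀ i → e i ≡ e' i) → ∃ λ i → e i ≢ e' i
  transversals-differ e e' e≢e' = ¬∀⟶∃¬ k _ (λ i → e i ≟ e' i) e≢e'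

  E-part-agrees : ∀ {e e'} → E e → E e' → ∀ i → part (e i) ≡ part (e' i)
  E-part-agrees {e} {e'} Ee Ee' i = trans (E-transversal e Ee i) (sym (E-transversal e' Ee' i))

  vertexSeparable⇒edgeSeparable : VertexSeparable G → EdgeSeparable G
  vertexSeparable⇒edgeSeparable separable e e' Ee Ee' e≢e'
    with i , eᵢ≢e'ᵢ ← transversals-differ e e' e≢e'
    with j , j≢i , separates ← separable (e i) (e' i) eᵢ≢e'ᵢ (E-part-agrees Ee Ee' i) =
    j , λ v v' p v∈e v'∈e' path →
      MeetsPart-strip-ends p (λ eq → j≢i (sym eq))
                             (λ eq → j≢i (trans (sym eq) (sym (E-part-agrees Ee Ee' i))))
        (separates _ (IsPath-extend-to-edges i Ee Ee' v∈e v'∈e' path))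

lemma4 : (k : ℕ) → k ≥ 1 → (G : KPartiteHypergraph k) →
    VertexSeparable G → EdgeSeparable G
lemma4 k _ G = vertexSeparable⇒edgeSeparable G
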